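{- Let $G$ be a finite simple graph that contains neither of the configurations (A), (B) described below. If $G$ contains one of the configurations (a), (b), (c), (d) described below via an injection $f$, then the graph obtained from $G$ by the 2-switch on $\langle f(p),f(q):f(r),f(s)\rangle$ is not isomorphic to $G$.
   Context: All graphs are finite and simple. An alternating 4-cycle $\langle a,b:c,d\rangle$ in a graph consists of four distinct vertices with $ab,cd$ edges and $bc,ad$ non-edges; the 2-switch on it deletes $ab,cd$ and adds $bc,ad$. A configuration is a triple $(V,E,F)$ with $(V,E)$ a graph and $F$ a set of vertex pairs not in $E$ (non-edges). A graph $G$ contains $(V,E,F)$ via an injection $f:V\to V(G)$ if $f(x)f(y)\in E(G)$ for all $xy\in E$ and $f(x)f(y)\notin E(G)$ for all $xy\in F$ (other pairs unconstrained). The configurations are: (a) vertices $p,q,r,s,w$; edges $pq,rs,qw,rw$; non-edges $qr,ps,pw,sw$. (b) vertices $p,q,r,s,w$; edges $pq,rs,pw,qw$; non-edges $qr,ps,rw,sw$. (c) vertices $p,q,r,s,y,z$; edges $pq,rs,pz,qy$; non-edges $qr,ps,rz,sy$. (d) vertices $p,q,r,s,y,z$; edges $pq,rs,ry,qz$; non-edges $qr,ps,py,sz$. (A) vertices $u,v,w,x,y,z$; edges $uv,wx,vy,wy,uz,vz$; non-edges $vw,ux,uy,xy,wz,xz$. (B) vertices $u,v,w,x,y,z,t$; edges $uv,wx,vy,uz,wt$; non-edges $vw,ux,xy,wz,ut$. -}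

module Defs where

open import Data.Nat using (ℕ)
open import Data.Fin using (Fin; zero; suc; _≟_)
open import Data.Bool using (Bool; true; false; _∧_; _∨_; if_then_else_)
open import Data.List using (List; []; _∷_)
open import Data.List.Relation.Unary.All using (All)
open import Data.Product using (Σ; _×_; _,_)
open import Relation.Nullary using (¬_)
open import Relation.Nullary.Decidable using (⌊_⌋)
open import Relation.Binary.PropositionalEquality using (_≡_)
open import Function.Bundles using (_⤖_; Bijection)
open import Function.Definitions using (Injective)

AdjRel : ℕ → Set
AdjRel n = Fin n → Fin n → Bool

IsSimple : {n : ℕ} → AdjRel n → Set
IsSimple {n} adj = (∀ (x y : Fin n) → adj x y ≡ adj y x) × (∀ (x : Fin n) → adj x x ≡ false)

samePair : {n : ℕ} → Fin n → Fin n → Fin n → Fin n → Bool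
samePair a b x y = (⌊ x ≟ a ⌋ ∧ ⌊ y ≟ b ⌋) ∨ (⌊ x ≟ b ⌋ ∧ ⌊ y ≟ a ⌋)

twoSwitch : {n : ℕ} → AdjRel n → Fin n → Fin n → Fin n → Fin n → AdjRel n
twoSwitch adj a b c d x y =
  if samePair a b x y ∨ samePair c d x y then false
  else if samePair b c x y ∨ samePair a d x y then true
  else adj x y

Isomorphic : {n : ℕ} → AdjRel n → AdjRel n → Set
Isomorphic {n} A B =
  Σ (Fin n ⤖ Fin n) λ σ → ∀ (x y : Fin n) → A x y ≡ B (Bijection.to σ x) (Bijection.to σ y)

-- Configurations (V,E,F) with V = Fin k.
-- The vertex count is 4 + extra, so every configuration has at least 4 vertices
-- (all configurations here have 5, 6 or 7); vertices are Fin (4 + extra).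
record Config : Set where
  field
    extra : ℕ
    edges : List (Fin (4 Data.Nat.+ extra) × Fin (4 Data.Nat.+ extra))
    nonEdges : List (Fin (4 Data.Nat.+ extra) × Fin (4 Data.Nat.+ extra))
open Config public

k : Config → ℕ
k C = 4 Data.Nat.+ extra C

vp vq vr vs : (C : Config) → Fin (k C)
vp C = zero
vq C = suc zero
vr C = suc (suc zero)
vs C = suc (suc (suc zero))

ContainsVia : {n : ℕ} → AdjRel n → (C : Config) → (Fin (k C) → Fin n) → Set
ContainsVia adj C f =
  Injective _≡_ _≡_ f
  × All (λ e → adj (f (Data.Product.proj₁ e)) (f (Data.Product.proj₂ e)) ≡ true) (edges C)
  × All (λ e → adj (f (Data.Product.proj₁ e)) (f (Data.Product.proj₂ e)) ≡ false) (nonEdges C)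

Contains : {n : ℕ} → AdjRel n → Config → Set
Contains {n} adj C = Σ (Fin (k C) → Fin n) λ f → ContainsVia adj C f

confa : Config
confa = record { extra = 1
  ; edges = (p , q) ∷ (r , s) ∷ (q , w) ∷ (r , w) ∷ []
  ; nonEdges = (q , r) ∷ (p , s) ∷ (p , w) ∷ (s , w) ∷ [] }
  where p q r s w : Fin 5
        p = zero ; q = suc zero ; r = suc (suc zero) ; s = suc (suc (suc zero)) ; w = suc (suc (suc (suc zero)))

confb : Config
confb = record { extra = 1
  ; edges = (p , q) ∷ (r , s) ∷ (p , w) ∷ (q , w) ∷ []
  ; nonEdges = (q , r) ∷ (p , s) ∷ (r , w) ∷ (s , w) ∷ [] }
  where p q r s w : Fin 5
        p = zero ; q = suc zero ; r = suc (suc zero) ; s = suc (suc (suc zero)) ; w = suc (suc (suc (suc zero)))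

confc : Config
confc = record { extra = 2
  ; edges = (p , q) ∷ (r , s) ∷ (p , z) ∷ (q , y) ∷ []
  ; nonEdges = (q , r) ∷ (p , s) ∷ (r , z) ∷ (s , y) ∷ [] }
  where p q r s y z : Fin 6
        p = zero ; q = suc zero ; r = suc (suc zero) ; s = suc (suc (suc zero))
        y = suc (suc (suc (suc zero))) ; z = suc (suc (suc (suc (suc zero))))

confd : Config
confd = record { extra = 2
  ; edges = (p , q) ∷ (r , s) ∷ (r , y) ∷ (q , z) ∷ []
  ; nonEdges = (q , r) ∷ (p , s) ∷ (p , y) ∷ (s , z) ∷ [] }
  where p q r s y z : Fin 6
        p = zero ; q = suc zero ; r = suc (suc zero) ; s = suc (suc (suc zero))
        y = suc (suc (suc (suc zero))) ; z = suc (suc (suc (suc (suc zero))))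

confA : Config
confA = record { extra = 2
  ; edges = (u , v) ∷ (w , x) ∷ (v , y) ∷ (w , y) ∷ (u , z) ∷ (v , z) ∷ []
  ; nonEdges = (v , w) ∷ (u , x) ∷ (u , y) ∷ (x , y) ∷ (w , z) ∷ (x , z) ∷ [] }
  where u v w x y z : Fin 6
        u = zero ; v = suc zero ; w = suc (suc zero) ; x = suc (suc (suc zero))
        y = suc (suc (suc (suc zero))) ; z = suc (suc (suc (suc (suc zero))))

confB : Config
confB = record { extra = 3
  ; edges = (u , v) ∷ (w , x) ∷ (v , y) ∷ (u , z) ∷ (w , t) ∷ []
  ; nonEdges = (v , w) ∷ (u , x) ∷ (x , y) ∷ (w , z) ∷ (u , t) ∷ [] }
  where u v w x y z t : Fin 7
        u = zero ; v = suc zero ; w = suc (suc zero) ; x = suc (suc (suc zero))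
        y = suc (suc (suc (suc zero))) ; z = suc (suc (suc (suc (suc zero))))
        t = suc (suc (suc (suc (suc (suc zero)))))


smallConfigs : List Config
smallConfigs = confa ∷ confb ∷ confc ∷ confd ∷ []

-- A 2-switch preserves all degrees, so an isomorphism between G and the switched graph G′ must
-- preserve both the number of triangles and the Zagreb index M₂ = Σ_{xy ∈ E} d(x) d(y).
-- Deleting pq, rs and inserting qr, ps changes M₂ by (d(q) − d(s)) (d(r) − d(p)), and changes the
-- triangle count by the number of common neighbours of q, r and of p, s minus those of p, q and of
-- r, s.  Among the vertices outside {p, q, r, s}, one whose neighbours in {p, q, r, s} are exactly
-- q, r or exactly p, s gains a triangle, one whose neighbours there are exactly p, q or exactly r, s
-- loses one, and every other vertex is balanced; excluding (A) says that a gainer and a loser never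
-- coexist.  Hence the vertex w of (a) or (b) changes the triangle count.  In (c) and (d), either y
-- or z is a gainer or a loser, or excluding (B) leaves no neighbour of s outside N(q), and none of r
-- outside N(p) (resp. of p outside N(r)), beyond the vertices of the configuration; then
-- d(s) < d(q) and d(r) ≠ d(p), so M₂ changes.

module Submission where

open import Defs

open import Data.Bool using (Bool; true; false; _∧_; _∨_; if_then_else_)
import Data.Bool as Bool
open import Data.Bool.Properties using (∨-comm; ∧-comm; ∧-zeroʳ; ∨-zeroʳ)
open import Data.Empty using (⊥)
open import Data.Fin using (Fin; zero; suc; _≟_; _↑ʳ_)
open import Data.Fin.Patterns using (0F; 1F; 2F; 3F)
import Data.Integer as ℤ
import Data.Integer.Properties as ℤ
import Data.Integer.Tactic.RingSolver as ℤ-Solver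
open import Data.List.Membership.Propositional using (_∈_)
open import Data.List.Relation.Unary.All using ([]; _∷_)
open import Data.List.Relation.Unary.Any using (here; there)
open import Data.Nat using (ℕ; _+_; _*_; _≤_; _<_; z≤n)
import Data.Nat.Properties as ℕ
open import Data.Nat.Tactic.RingSolver using (solve-∀)
open import Data.Product using (_×_; _,_; proj₁; proj₂)
open import Data.Sum using (_⊎_; inj₁; inj₂)
open import Data.Vec using (Vec; []; _∷_; lookup)
open import Data.Vec.Relation.Unary.All using ([]; _∷_)
open import Data.Vec.Relation.Unary.AllPairs using ([]; _∷_)
open import Data.Vec.Relation.Unary.Unique.Propositional using (Unique)
open import Data.Vec.Relation.Unary.Unique.Propositional.Properties using (lookup-injective)
open import Function.Base using (case_of_; _∘₂_)
open import Function.Bundles using (_⤖_; Bijection)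
open import Function.Definitions using (Injective)
open import Function.Properties.Bijection using (⤖⇒↔)
open import Relation.Binary.PropositionalEquality
open import Relation.Nullary using (¬_; Dec; yes; no; contradiction)
open import Relation.Nullary.Decidable using (⌊_⌋; _×-dec_)

open import Algebra.Properties.Semiring.Sum ℕ.+-*-semiring
  using (sum; sum-syntax; sum-replicate-zero; sum-cong-≗; ∑-distrib-+; ∑-comm; sum-permute; *-distribˡ-sum)

-- Indicator sums over Fin n

𝟙 : Bool → ℕ
𝟙 true = 1
𝟙 false = 0

δ : {n : ℕ} → Fin n → Fin n → ℕ
δ c x = 𝟙 ⌊ x ≟ c ⌋

≟-refl : {n : ℕ} (c : Fin n) → ⌊ c ≟ c ⌋ ≡ true
≟-refl c with c ≟ c
... | yes _ = refl
... | no c≢c = contradiction refl c≢c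

≟-≢ : {n : ℕ} {x c : Fin n} → x ≢ c → ⌊ x ≟ c ⌋ ≡ false
≟-≢ {x = x} {c} x≢c with x ≟ c
... | yes x≡c = contradiction x≡c x≢c
... | no _ = refl

≟-sound : {n : ℕ} {x c : Fin n} → ⌊ x ≟ c ⌋ ≡ true → x ≡ c
≟-sound {x = x} {c} h with x ≟ c
... | yes x≡c = x≡c

∧-true : ∀ a {b} → a ∧ b ≡ true → a ≡ true × b ≡ true
∧-true true refl = refl , refl

∨-true : ∀ a {b} → a ∨ b ≡ true → a ≡ true ⊎ b ≡ true
∨-true true _ = inj₁ refl
∨-true false b≡true = inj₂ b≡true

¬true⇒false : ∀ {a} → ¬ (a ≡ true) → a ≡ false
¬true⇒false {false} _ = refl
¬true⇒false {true} a≢true = contradiction refl a≢true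

𝟙-∧ : ∀ a b → 𝟙 (a ∧ b) ≡ 𝟙 a * 𝟙 b
𝟙-∧ false b = refl
𝟙-∧ true b = sym (ℕ.+-identityʳ (𝟙 b))

𝟙-∨ : ∀ a b → a ∧ b ≡ false → 𝟙 (a ∨ b) ≡ 𝟙 a + 𝟙 b
𝟙-∨ true false _ = refl
𝟙-∨ false b _ = refl

𝟙-true : ∀ {a} → 𝟙 a ≡ 1 → a ≡ true
𝟙-true {true} _ = refl

𝟙-pair : ∀ a b → 𝟙 a * 𝟙 b + 𝟙 b * 𝟙 a ≡ 2 * 𝟙 (a ∧ b)
𝟙-pair true true = refl
𝟙-pair true false = refl
𝟙-pair false true = refl
𝟙-pair false false = refl

𝟙-∧-zeroˡ : ∀ {a} b → a ≡ false → 𝟙 (a ∧ b) ≡ 0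
𝟙-∧-zeroˡ b refl = refl

𝟙-∧-zeroʳ : ∀ a {b} → b ≡ false → 𝟙 (a ∧ b) ≡ 0
𝟙-∧-zeroʳ a refl = cong 𝟙 (∧-zeroʳ a)

𝟙-mono : ∀ {a b} → ¬ (a ≡ true × b ≡ false) → 𝟙 a ≤ 𝟙 b
𝟙-mono {false} _ = z≤n
𝟙-mono {true} {true} _ = ℕ.≤-refl
𝟙-mono {true} {false} a⇏b = contradiction (refl , refl) a⇏b

sides-≤ : ∀ P Q R S → ¬ (P ≡ true × Q ≡ true × R ≡ false × S ≡ false) → ¬ (R ≡ true × S ≡ true × P ≡ false × Q ≡ false) →
  𝟙 (P ∧ Q) + 𝟙 (R ∧ S) ≤ 𝟙 (Q ∧ R) + 𝟙 (P ∧ S)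
sides-≤ true  true  true  true  _ _ = ℕ.≤-refl
sides-≤ true  true  true  false _ _ = ℕ.≤-refl
sides-≤ true  true  false true  _ _ = ℕ.≤-refl
sides-≤ true  true  false false ¬pq _ = contradiction (refl , refl , refl , refl) ¬pq
sides-≤ true  false true  true  _ _ = ℕ.≤-refl
sides-≤ true  false true  false _ _ = z≤n
sides-≤ true  false false true  _ _ = z≤n
sides-≤ true  false false false _ _ = z≤n
sides-≤ false true  true  true  _ _ = ℕ.≤-refl
sides-≤ false true  true  false _ _ = z≤n
sides-≤ false true  false true  _ _ = z≤n
sides-≤ false true  false false _ _ = z≤n
sides-≤ false false true  true  _ ¬rs = contradiction (refl , refl , refl , refl) ¬rs
sides-≤ false false true  false _ _ = z≤n
sides-≤ false false false true  _ _ = z≤n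
sides-≤ false false false false _ _ = z≤n

δ-suc : {n : ℕ} (c x : Fin n) → δ (suc c) (suc x) ≡ δ c x
δ-suc c x with x ≟ c
... | yes _ = refl
... | no _ = refl

sum-δ : {n : ℕ} (c : Fin n) (f : Fin n → ℕ) → sum (λ x → δ c x * f x) ≡ f c
sum-δ {ℕ.suc n} zero f = begin
  1 * f zero + sum {n} (λ _ → 0) ≡⟨ cong₂ _+_ (ℕ.*-identityˡ (f zero)) (sum-replicate-zero n) ⟩
  f zero + 0                     ≡⟨ ℕ.+-identityʳ (f zero) ⟩
  f zero                         ∎
  where open ≡-Reasoning
sum-δ {ℕ.suc n} (suc c) f = trans (sum-cong-≗ {n} λ i → cong (_* f (suc i)) (δ-suc c i)) (sum-δ {n} c (λ i → f (suc i)))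

sum-δ-one : {n : ℕ} (c : Fin n) → sum (δ c) ≡ 1
sum-δ-one c = trans (sum-cong-≗ λ x → sym (ℕ.*-identityʳ (δ c x))) (sum-δ c (λ _ → 1))

sum-δ-∧ : {n : ℕ} (c : Fin n) (b : Bool) → ∑[ x < n ] 𝟙 (⌊ x ≟ c ⌋ ∧ b) ≡ 𝟙 b
sum-δ-∧ c b = trans (sum-cong-≗ λ x → 𝟙-∧ ⌊ x ≟ c ⌋ b) (sum-δ c (λ _ → 𝟙 b))

sum-mono-≤ : {n : ℕ} {f g : Fin n → ℕ} → (∀ i → f i ≤ g i) → sum f ≤ sum g
sum-mono-≤ {ℕ.zero} f≤g = z≤n
sum-mono-≤ {ℕ.suc n} f≤g = ℕ.+-mono-≤ (f≤g zero) (sum-mono-≤ (λ i → f≤g (suc i)))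

sum-mono-< : {n : ℕ} {f g : Fin n → ℕ} → (∀ i → f i ≤ g i) → (w : Fin n) → f w < g w → sum f < sum g
sum-mono-< f≤g zero fw<gw = ℕ.+-mono-<-≤ fw<gw (sum-mono-≤ (λ i → f≤g (suc i)))
sum-mono-< f≤g (suc w) fw<gw = ℕ.+-mono-≤-< (f≤g zero) (sum-mono-< (λ i → f≤g (suc i)) w fw<gw)

sum-+-cong : {n : ℕ} {f g h k : Fin n → ℕ} → (∀ i → f i + g i ≡ h i + k i) → sum f + sum g ≡ sum h + sum k
sum-+-cong {f = f} {g} {h} {k} pointwise =
  trans (sym (∑-distrib-+ f g)) (trans (sum-cong-≗ pointwise) (∑-distrib-+ h k))

module _ {n : ℕ} where

  ∑₃ : (Fin n → Fin n → Fin n → ℕ) → ℕ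
  ∑₃ f = ∑[ z < n ] ∑[ x < n ] ∑[ y < n ] f z x y

  ∑₃-cong : {f g : Fin n → Fin n → Fin n → ℕ} → (∀ z x y → f z x y ≡ g z x y) → ∑₃ f ≡ ∑₃ g
  ∑₃-cong f≡g = sum-cong-≗ λ z → sum-cong-≗ λ x → sum-cong-≗ λ y → f≡g z x y

  ∑₃-swap₁₂ : (f : Fin n → Fin n → Fin n → ℕ) → ∑₃ f ≡ ∑₃ (λ z x y → f x z y)
  ∑₃-swap₁₂ f = ∑-comm (λ z x → ∑[ y < n ] f z x y)

  ∑₃-swap₁₃ : (f : Fin n → Fin n → Fin n → ℕ) → ∑₃ f ≡ ∑₃ (λ z x y → f y x z)
  ∑₃-swap₁₃ f = begin
    ∑[ z < n ] ∑[ x < n ] ∑[ y < n ] f z x y ≡⟨ sum-cong-≗ (λ z → ∑-comm (f z)) ⟩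
    ∑[ z < n ] ∑[ y < n ] ∑[ x < n ] f z x y ≡⟨ ∑-comm (λ z y → ∑[ x < n ] f z x y) ⟩
    ∑[ y < n ] ∑[ z < n ] ∑[ x < n ] f z x y ≡⟨ sum-cong-≗ (λ y → ∑-comm (λ z x → f z x y)) ⟩
    ∑[ y < n ] ∑[ x < n ] ∑[ z < n ] f z x y ∎
    where open ≡-Reasoning

  ∑₃-distrib-+ : (f g : Fin n → Fin n → Fin n → ℕ) → ∑₃ (λ z x y → f z x y + g z x y) ≡ ∑₃ f + ∑₃ g
  ∑₃-distrib-+ f g = trans
    (sum-cong-≗ λ z → trans (sum-cong-≗ λ x → ∑-distrib-+ (f z x) (g z x))
                            (∑-distrib-+ (λ x → sum (f z x)) (λ x → sum (g z x))))
    (∑-distrib-+ (λ z → ∑[ x < n ] sum (f z x)) (λ z → ∑[ x < n ] sum (g z x)))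

  ∑₃-symmetrize : (B W : Fin n → Fin n → ℕ) → (∀ x y → B x y ≡ B y x) → (∀ x y → W x y ≡ W y x) →
    ∑₃ (λ z x y → W x y * B x z * B y z + B x y * W x z * B y z + B x y * B x z * W y z)
    ≡ 3 * ∑₃ (λ z x y → W x y * B x z * B y z)
  ∑₃-symmetrize B W B-sym W-sym = begin
    ∑₃ (λ z x y → t₁ z x y + t₂ z x y + t₃ z x y)  ≡⟨ ∑₃-distrib-+ (λ z x y → t₁ z x y + t₂ z x y) t₃ ⟩
    ∑₃ (λ z x y → t₁ z x y + t₂ z x y) + ∑₃ t₃     ≡⟨ cong (_+ ∑₃ t₃) (∑₃-distrib-+ t₁ t₂) ⟩
    ∑₃ t₁ + ∑₃ t₂ + ∑₃ t₃                          ≡⟨ cong₂ (λ u v → ∑₃ t₁ + u + v) t₂≡t₁ t₃≡t₁ ⟩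
    ∑₃ t₁ + ∑₃ t₁ + ∑₃ t₁                          ≡⟨ thrice (∑₃ t₁) ⟩
    3 * ∑₃ t₁                                      ∎
    where
    open ≡-Reasoning
    thrice : ∀ m → m + m + m ≡ 3 * m
    thrice = solve-∀
    reverse₃ : ∀ a b c → a * b * c ≡ c * b * a
    reverse₃ = solve-∀
    t₁ t₂ t₃ : Fin n → Fin n → Fin n → ℕ
    t₁ z x y = W x y * B x z * B y z
    t₂ z x y = B x y * W x z * B y z
    t₃ z x y = B x y * B x z * W y z
    t₂≡t₁ : ∑₃ t₂ ≡ ∑₃ t₁
    t₂≡t₁ = trans (∑₃-swap₁₃ t₂) (∑₃-cong λ z x y →
      cong₂ _*_ (ℕ.*-comm (B x z) (W x y)) (B-sym z y))
    t₃≡t₁ : ∑₃ t₃ ≡ ∑₃ t₁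
    t₃≡t₁ = trans (∑₃-swap₁₂ t₃) (∑₃-cong λ z x y →
      trans (cong₂ _*_ (cong₂ _*_ (B-sym z y) (B-sym z x)) (W-sym y x)) (reverse₃ (B y z) (B x z) (W x y)))

module _ {n : ℕ} (σ : Fin n ⤖ Fin n) where
  private
    π = Bijection.to σ

  sum-reindex : (f : Fin n → ℕ) → ∑[ x < n ] f (π x) ≡ sum f
  sum-reindex f = sym (sum-permute f (⤖⇒↔ σ))

  sum₂-reindex : (f : Fin n → Fin n → ℕ) → ∑[ x < n ] ∑[ y < n ] f (π x) (π y) ≡ ∑[ x < n ] ∑[ y < n ] f x y
  sum₂-reindex f = trans (sum-cong-≗ λ x → sum-reindex (f (π x))) (sum-reindex λ x → sum (f x))

  ∑₃-reindex : (f : Fin n → Fin n → Fin n → ℕ) → ∑₃ (λ z x y → f (π z) (π x) (π y)) ≡ ∑₃ f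
  ∑₃-reindex f = trans (sum-cong-≗ λ z → sum₂-reindex (f (π z))) (sum-reindex λ z → ∑[ x < n ] ∑[ y < n ] f z x y)

products-balanced : ∀ a b c d → a * b + c * d ≡ b * c + a * d → a ≡ c ⊎ b ≡ d
products-balanced a b c d eq with ℤ.i*j≡0⇒i≡0∨j≡0 (ℤ.+ a ℤ.- ℤ.+ c) product≡0
  where
  open ≡-Reasoning
  lift : ∀ i j k l → ℤ.+ (i * j + k * l) ≡ ℤ.+ i ℤ.* ℤ.+ j ℤ.+ ℤ.+ k ℤ.* ℤ.+ l
  lift i j k l = trans (ℤ.pos-+ (i * j) (k * l)) (cong₂ ℤ._+_ (ℤ.pos-* i j) (ℤ.pos-* k l))
  expand : ∀ i j k l → (i ℤ.- k) ℤ.* (j ℤ.- l) ≡ (i ℤ.* j ℤ.+ k ℤ.* l) ℤ.- (j ℤ.* k ℤ.+ i ℤ.* l)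
  expand = ℤ-Solver.solve-∀
  product≡0 : (ℤ.+ a ℤ.- ℤ.+ c) ℤ.* (ℤ.+ b ℤ.- ℤ.+ d) ≡ ℤ.0ℤ
  product≡0 = begin
    (ℤ.+ a ℤ.- ℤ.+ c) ℤ.* (ℤ.+ b ℤ.- ℤ.+ d)
      ≡⟨ expand (ℤ.+ a) (ℤ.+ b) (ℤ.+ c) (ℤ.+ d) ⟩
    (ℤ.+ a ℤ.* ℤ.+ b ℤ.+ ℤ.+ c ℤ.* ℤ.+ d) ℤ.- (ℤ.+ b ℤ.* ℤ.+ c ℤ.+ ℤ.+ a ℤ.* ℤ.+ d)
      ≡⟨ cong₂ ℤ._-_ (lift a b c d) (lift b c a d) ⟨
    ℤ.+ (a * b + c * d) ℤ.- ℤ.+ (b * c + a * d)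
      ≡⟨ cong (λ i → ℤ.+ i ℤ.- ℤ.+ (b * c + a * d)) eq ⟩
    ℤ.+ (b * c + a * d) ℤ.- ℤ.+ (b * c + a * d)
      ≡⟨ ℤ.+-inverseʳ (ℤ.+ (b * c + a * d)) ⟩
    ℤ.0ℤ ∎
... | inj₁ a-c≡0 = inj₁ (ℤ.+-injective (ℤ.i-j≡0⇒i≡j (ℤ.+ a) (ℤ.+ c) a-c≡0))
... | inj₂ b-d≡0 = inj₂ (ℤ.+-injective (ℤ.i-j≡0⇒i≡j (ℤ.+ b) (ℤ.+ d) b-d≡0))

module _ {n : ℕ} where

  samePair-sound : (a b x y : Fin n) → samePair a b x y ≡ true → (x ≡ a × y ≡ b) ⊎ (x ≡ b × y ≡ a)
  samePair-sound a b x y h with ∨-true (⌊ x ≟ a ⌋ ∧ ⌊ y ≟ b ⌋) h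
  ... | inj₁ xy≡ab = let (x≡a , y≡b) = ∧-true _ xy≡ab in inj₁ (≟-sound x≡a , ≟-sound y≡b)
  ... | inj₂ xy≡ba = let (x≡b , y≡a) = ∧-true _ xy≡ba in inj₂ (≟-sound x≡b , ≟-sound y≡a)

  samePair-sym : (a b x y : Fin n) → samePair a b x y ≡ samePair a b y x
  samePair-sym a b x y = trans (∨-comm (⌊ x ≟ a ⌋ ∧ ⌊ y ≟ b ⌋) _)
    (cong₂ _∨_ (∧-comm ⌊ x ≟ b ⌋ ⌊ y ≟ a ⌋) (∧-comm ⌊ x ≟ a ⌋ ⌊ y ≟ b ⌋))

  samePair-∉ : {a b x : Fin n} (y : Fin n) → x ≢ a → x ≢ b → samePair a b x y ≡ false
  samePair-∉ y x≢a x≢b rewrite ≟-≢ x≢a | ≟-≢ x≢b = refl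

  𝟙-samePair : {a b : Fin n} → a ≢ b → (x y : Fin n) → 𝟙 (samePair a b x y) ≡ δ a x * δ b y + δ b x * δ a y
  𝟙-samePair {a} {b} a≢b x y =
    trans (𝟙-∨ (⌊ x ≟ a ⌋ ∧ ⌊ y ≟ b ⌋) _ disjoint) (cong₂ _+_ (𝟙-∧ ⌊ x ≟ a ⌋ _) (𝟙-∧ ⌊ x ≟ b ⌋ _))
    where
    disjoint : (⌊ x ≟ a ⌋ ∧ ⌊ y ≟ b ⌋) ∧ (⌊ x ≟ b ⌋ ∧ ⌊ y ≟ a ⌋) ≡ false
    disjoint with x ≟ a
    ... | no _ = refl
    ... | yes refl rewrite ≟-≢ a≢b = ∧-zeroʳ _

  sum-samePair : {a b : Fin n} → a ≢ b → (x : Fin n) (g : Fin n → ℕ) →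
    ∑[ y < n ] (𝟙 (samePair a b x y) * g y) ≡ δ a x * g b + δ b x * g a
  sum-samePair {a} {b} a≢b x g = begin
    ∑[ y < n ] (𝟙 (samePair a b x y) * g y)
      ≡⟨ sum-cong-≗ (λ y → trans (cong (_* g y) (𝟙-samePair a≢b x y)) (expand (δ a x) (δ b y) (δ b x) (δ a y) (g y))) ⟩
    ∑[ y < n ] (δ a x * (δ b y * g y) + δ b x * (δ a y * g y))
      ≡⟨ ∑-distrib-+ (λ y → δ a x * (δ b y * g y)) (λ y → δ b x * (δ a y * g y)) ⟩
    ∑[ y < n ] (δ a x * (δ b y * g y)) + ∑[ y < n ] (δ b x * (δ a y * g y))
      ≡⟨ cong₂ _+_ (sym (*-distribˡ-sum (δ a x) (λ y → δ b y * g y))) (sym (*-distribˡ-sum (δ b x) (λ y → δ a y * g y))) ⟩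
    δ a x * ∑[ y < n ] (δ b y * g y) + δ b x * ∑[ y < n ] (δ a y * g y)
      ≡⟨ cong₂ _+_ (cong (δ a x *_) (sum-δ b g)) (cong (δ b x *_) (sum-δ a g)) ⟩
    δ a x * g b + δ b x * g a ∎
    where
    open ≡-Reasoning
    expand : ∀ i j k l m → (i * j + k * l) * m ≡ i * (j * m) + k * (l * m)
    expand i j k l m = trans (ℕ.*-distribʳ-+ m (i * j) (k * l)) (cong₂ _+_ (ℕ.*-assoc i j m) (ℕ.*-assoc k l m))

Outside : {n : ℕ} → Fin n → Fin n → Fin n → Fin n → Fin n → Set
Outside p q r s z = p ≢ z × q ≢ z × r ≢ z × s ≢ z

module TwoPairs {n : ℕ} {a b c d : Fin n}
  (a≢b : a ≢ b) (a≢c : a ≢ c) (a≢d : a ≢ d) (b≢c : b ≢ c) (b≢d : b ≢ d) (c≢d : c ≢ d) where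

  paired : Fin n → Fin n → Bool
  paired x y = samePair a b x y ∨ samePair c d x y

  paired-elim : (P : Fin n → Fin n → Set) → P a b → P b a → P c d → P d c →
    {x y : Fin n} → paired x y ≡ true → P x y
  paired-elim P ab ba cd dc {x} {y} h with ∨-true (samePair a b x y) h
  ... | inj₁ h₁ with samePair-sound a b x y h₁
  ...   | inj₁ (refl , refl) = ab
  ...   | inj₂ (refl , refl) = ba
  paired-elim P ab ba cd dc {x} {y} h | inj₂ h₂ with samePair-sound c d x y h₂
  ...   | inj₁ (refl , refl) = cd
  ...   | inj₂ (refl , refl) = dc

  paired-first : paired a b ≡ true
  paired-first rewrite ≟-refl a | ≟-refl b = refl

  paired-second : paired c d ≡ true
  paired-second rewrite ≟-refl c | ≟-refl d = ∨-zeroʳ _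

  paired-sym : (x y : Fin n) → paired x y ≡ paired y x
  paired-sym x y = cong₂ _∨_ (samePair-sym a b x y) (samePair-sym c d x y)

  paired-irrefl : (x : Fin n) → paired x x ≡ false
  paired-irrefl x = ¬true⇒false λ h → paired-elim (λ x y → x ≢ y) a≢b (≢-sym a≢b) c≢d (≢-sym c≢d) {x} {x} h refl

  paired-outside : (x : Fin n) {y : Fin n} → Outside a b c d y → paired x y ≡ false
  paired-outside x {y} (a≢y , b≢y , c≢y , d≢y) = cong₂ _∨_
    (trans (samePair-sym a b x y) (samePair-∉ x (≢-sym a≢y) (≢-sym b≢y)))
    (trans (samePair-sym c d x y) (samePair-∉ x (≢-sym c≢y) (≢-sym d≢y)))

  partner : Fin n → Fin n
  partner x = if ⌊ x ≟ a ⌋ then b else if ⌊ x ≟ b ⌋ then a else if ⌊ x ≟ c ⌋ then d else c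

  paired-partner : {x y : Fin n} → paired x y ≡ true → y ≡ partner x
  paired-partner {x} {y} = paired-elim (λ x y → y ≡ partner x) at-a at-b at-c at-d {x} {y}
    where
    at-a : b ≡ partner a
    at-a rewrite ≟-refl a = refl
    at-b : a ≡ partner b
    at-b rewrite ≟-≢ (≢-sym a≢b) | ≟-refl b = refl
    at-c : d ≡ partner c
    at-c rewrite ≟-≢ (≢-sym a≢c) | ≟-≢ (≢-sym b≢c) | ≟-refl c = refl
    at-d : c ≡ partner d
    at-d rewrite ≟-≢ (≢-sym a≢d) | ≟-≢ (≢-sym b≢d) | ≟-≢ (≢-sym c≢d) = refl

  paired-unique : {x y z : Fin n} → paired x y ≡ true → paired x z ≡ true → y ≡ z
  paired-unique {x} xy xz = trans (paired-partner {x} xy) (sym (paired-partner {x} xz))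

  sum-paired : (x : Fin n) (g : Fin n → ℕ) →
    ∑[ y < n ] (𝟙 (paired x y) * g y) ≡ δ a x * g b + δ b x * g a + (δ c x * g d + δ d x * g c)
  sum-paired x g = begin
    ∑[ y < n ] (𝟙 (paired x y) * g y)
      ≡⟨ sum-cong-≗ (λ y → trans (cong (_* g y) (𝟙-∨ (samePair a b x y) _ (disjoint y)))
                                  (ℕ.*-distribʳ-+ (g y) (𝟙 (samePair a b x y)) _)) ⟩
    ∑[ y < n ] (𝟙 (samePair a b x y) * g y + 𝟙 (samePair c d x y) * g y)
      ≡⟨ ∑-distrib-+ (λ y → 𝟙 (samePair a b x y) * g y) (λ y → 𝟙 (samePair c d x y) * g y) ⟩
    ∑[ y < n ] (𝟙 (samePair a b x y) * g y) + ∑[ y < n ] (𝟙 (samePair c d x y) * g y)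
      ≡⟨ cong₂ _+_ (sum-samePair a≢b x g) (sum-samePair c≢d x g) ⟩
    δ a x * g b + δ b x * g a + (δ c x * g d + δ d x * g c) ∎
    where
    open ≡-Reasoning
    disjoint : ∀ y → samePair a b x y ∧ samePair c d x y ≡ false
    disjoint y = ¬true⇒false λ h → let (h₁ , h₂) = ∧-true _ h in
      meet (samePair-sound a b x y h₁) (samePair-sound c d x y h₂)
      where
      meet : (x ≡ a × y ≡ b) ⊎ (x ≡ b × y ≡ a) → (x ≡ c × y ≡ d) ⊎ (x ≡ d × y ≡ c) → ⊥
      meet (inj₁ (refl , _)) (inj₁ (a≡c , _)) = a≢c a≡c
      meet (inj₁ (refl , _)) (inj₂ (a≡d , _)) = a≢d a≡d
      meet (inj₂ (refl , _)) (inj₁ (b≡c , _)) = b≢c b≡c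
      meet (inj₂ (refl , _)) (inj₂ (b≡d , _)) = b≢d b≡d

  sum₂-paired : (G : Fin n → Fin n → ℕ) →
    ∑[ x < n ] ∑[ y < n ] (𝟙 (paired x y) * G x y) ≡ G a b + G b a + (G c d + G d c)
  sum₂-paired G = begin
    ∑[ x < n ] ∑[ y < n ] (𝟙 (paired x y) * G x y)
      ≡⟨ sum-cong-≗ (λ x → sum-paired x (G x)) ⟩
    ∑[ x < n ] (δ a x * G x b + δ b x * G x a + (δ c x * G x d + δ d x * G x c))
      ≡⟨ ∑-distrib-+ (λ x → δ a x * G x b + δ b x * G x a) (λ x → δ c x * G x d + δ d x * G x c) ⟩
    ∑[ x < n ] (δ a x * G x b + δ b x * G x a) + ∑[ x < n ] (δ c x * G x d + δ d x * G x c)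
      ≡⟨ cong₂ _+_ (two a b) (two c d) ⟩
    G a b + G b a + (G c d + G d c) ∎
    where
    open ≡-Reasoning
    two : ∀ i j → ∑[ x < n ] (δ i x * G x j + δ j x * G x i) ≡ G i j + G j i
    two i j = trans (∑-distrib-+ (λ x → δ i x * G x j) (λ x → δ j x * G x i))
                    (cong₂ _+_ (sum-δ i (λ x → G x j)) (sum-δ j (λ x → G x i)))

  paired-shared : (B : AdjRel n) → (∀ v → B v v ≡ false) →
    (x y z : Fin n) → paired x y ≡ true → paired x z ≡ true → B y z ≡ false
  paired-shared B irreflexive x y z xy xz = subst (λ w → B y w ≡ false) (paired-unique {x} xy xz) (irreflexive y)

  sum₃-paired : (B : AdjRel n) → ∑₃ (λ z x y → 𝟙 (paired x y) * 𝟙 (B x z) * 𝟙 (B y z))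
                               ≡ 2 * ∑[ z < n ] (𝟙 (B a z ∧ B b z) + 𝟙 (B c z ∧ B d z))
  sum₃-paired B = begin
    ∑₃ (λ z x y → 𝟙 (paired x y) * 𝟙 (B x z) * 𝟙 (B y z))
      ≡⟨ sum-cong-≗ (λ z → trans (sum-cong-≗ λ x → sum-cong-≗ λ y → ℕ.*-assoc (𝟙 (paired x y)) _ _)
                                 (sum₂-paired (λ x y → 𝟙 (B x z) * 𝟙 (B y z)))) ⟩
    ∑[ z < n ] (ab z + ba z + (cd z + dc z))
      ≡⟨ sum-cong-≗ (λ z → trans (cong₂ _+_ (𝟙-pair (B a z) (B b z)) (𝟙-pair (B c z) (B d z)))
                                 (sym (ℕ.*-distribˡ-+ 2 (𝟙 (B a z ∧ B b z)) _))) ⟩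
    ∑[ z < n ] (2 * (𝟙 (B a z ∧ B b z) + 𝟙 (B c z ∧ B d z)))
      ≡⟨ *-distribˡ-sum 2 (λ z → 𝟙 (B a z ∧ B b z) + 𝟙 (B c z ∧ B d z)) ⟨
    2 * ∑[ z < n ] (𝟙 (B a z ∧ B b z) + 𝟙 (B c z ∧ B d z)) ∎
    where
    open ≡-Reasoning
    ab ba cd dc : Fin n → ℕ
    ab z = 𝟙 (B a z) * 𝟙 (B b z)
    ba z = 𝟙 (B b z) * 𝟙 (B a z)
    cd z = 𝟙 (B c z) * 𝟙 (B d z)
    dc z = 𝟙 (B d z) * 𝟙 (B c z)

-- The 2-switch, one adjacency bit at a time

data Change : Bool → Bool → ℕ → ℕ → Set where
  kept : (b : Bool) → Change b b 0 0
  removed : Change true false 1 0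
  inserted : Change false true 0 1

change-balance : ∀ {a a′ e f} → Change a a′ e f → 𝟙 a′ + e ≡ 𝟙 a + f
change-balance (kept true) = refl
change-balance (kept false) = refl
change-balance removed = refl
change-balance inserted = refl

change-balance-* : ∀ {a a′ e f} → Change a a′ e f → ∀ m → 𝟙 a′ * m + e * m ≡ 𝟙 a * m + f * m
change-balance-* {a} {a′} {e} {f} c m = begin
  𝟙 a′ * m + e * m ≡⟨ ℕ.*-distribʳ-+ m (𝟙 a′) e ⟨
  (𝟙 a′ + e) * m   ≡⟨ cong (_* m) (change-balance c) ⟩
  (𝟙 a + f) * m    ≡⟨ ℕ.*-distribʳ-+ m (𝟙 a) f ⟩
  𝟙 a * m + f * m  ∎
  where open ≡-Reasoning

switched : Bool → Bool → Bool → Bool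
switched e f a = if e then false else if f then true else a

switch-change : ∀ {a} e f → (e ≡ true → a ≡ true) → (f ≡ true → a ≡ false) → Change a (switched e f a) (𝟙 e) (𝟙 f)
switch-change {true} true false _ _ = removed
switch-change {false} true _ e⇒a _ = case e⇒a refl of λ ()
switch-change {true} true true _ f⇒¬a = case f⇒¬a refl of λ ()
switch-change {false} false true _ _ = inserted
switch-change {true} false true _ f⇒¬a = case f⇒¬a refl of λ ()
switch-change {a} false false _ _ = kept a

-- The three changes are those of the pairs xy, xz, yz of a triple; checked over all 64 combinations.
triangle-balance : ∀ {a₁ a₁′ e₁ f₁ a₂ a₂′ e₂ f₂ a₃ a₃′ e₃ f₃} →
  Change a₁ a₁′ e₁ f₁ → Change a₂ a₂′ e₂ f₂ → Change a₃ a₃′ e₃ f₃ →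
  (e₁ ≡ 1 → e₂ ≡ 1 → a₃ ≡ false) → (e₁ ≡ 1 → e₃ ≡ 1 → a₂ ≡ false) → (e₂ ≡ 1 → e₃ ≡ 1 → a₁ ≡ false) →
  (f₁ ≡ 1 → f₂ ≡ 1 → a₃′ ≡ false) → (f₁ ≡ 1 → f₃ ≡ 1 → a₂′ ≡ false) → (f₂ ≡ 1 → f₃ ≡ 1 → a₁′ ≡ false) →
  𝟙 a₁′ * 𝟙 a₂′ * 𝟙 a₃′ + (e₁ * 𝟙 a₂ * 𝟙 a₃ + 𝟙 a₁ * e₂ * 𝟙 a₃ + 𝟙 a₁ * 𝟙 a₂ * e₃)
  ≡ 𝟙 a₁ * 𝟙 a₂ * 𝟙 a₃ + (f₁ * 𝟙 a₂′ * 𝟙 a₃′ + 𝟙 a₁′ * f₂ * 𝟙 a₃′ + 𝟙 a₁′ * 𝟙 a₂′ * f₃)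
triangle-balance (kept false) _ _ _ _ _ _ _ _ = refl
triangle-balance (kept true) (kept true) (kept true) _ _ _ _ _ _ = refl
triangle-balance (kept true) (kept true) (kept false) _ _ _ _ _ _ = refl
triangle-balance (kept true) (kept true) removed _ _ _ _ _ _ = refl
triangle-balance (kept true) (kept true) inserted _ _ _ _ _ _ = refl
triangle-balance (kept true) (kept false) (kept true) _ _ _ _ _ _ = refl
triangle-balance (kept true) (kept false) (kept false) _ _ _ _ _ _ = refl
triangle-balance (kept true) (kept false) removed _ _ _ _ _ _ = refl
triangle-balance (kept true) (kept false) inserted _ _ _ _ _ _ = refl
triangle-balance (kept true) removed (kept true) _ _ _ _ _ _ = refl
triangle-balance (kept true) removed (kept false) _ _ _ _ _ _ = refl
triangle-balance (kept true) removed removed _ _ r₂₃ _ _ _ = case r₂₃ refl refl of λ ()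
triangle-balance (kept true) removed inserted _ _ _ _ _ _ = refl
triangle-balance (kept true) inserted (kept true) _ _ _ _ _ _ = refl
triangle-balance (kept true) inserted (kept false) _ _ _ _ _ _ = refl
triangle-balance (kept true) inserted removed _ _ _ _ _ _ = refl
triangle-balance (kept true) inserted inserted _ _ _ _ _ i₂₃ = case i₂₃ refl refl of λ ()
triangle-balance removed (kept true) (kept true) _ _ _ _ _ _ = refl
triangle-balance removed (kept true) (kept false) _ _ _ _ _ _ = refl
triangle-balance removed (kept true) removed _ r₁₃ _ _ _ _ = case r₁₃ refl refl of λ ()
triangle-balance removed (kept true) inserted _ _ _ _ _ _ = refl
triangle-balance removed (kept false) (kept true) _ _ _ _ _ _ = refl
triangle-balance removed (kept false) (kept false) _ _ _ _ _ _ = refl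
triangle-balance removed (kept false) removed _ _ _ _ _ _ = refl
triangle-balance removed (kept false) inserted _ _ _ _ _ _ = refl
triangle-balance removed removed (kept true) r₁₂ _ _ _ _ _ = case r₁₂ refl refl of λ ()
triangle-balance removed removed (kept false) _ _ _ _ _ _ = refl
triangle-balance removed removed removed r₁₂ _ _ _ _ _ = case r₁₂ refl refl of λ ()
triangle-balance removed removed inserted _ _ _ _ _ _ = refl
triangle-balance removed inserted (kept true) _ _ _ _ _ _ = refl
triangle-balance removed inserted (kept false) _ _ _ _ _ _ = refl
triangle-balance removed inserted removed _ _ _ _ _ _ = refl
triangle-balance removed inserted inserted _ _ _ _ _ _ = refl
triangle-balance inserted (kept true) (kept true) _ _ _ _ _ _ = refl
triangle-balance inserted (kept true) (kept false) _ _ _ _ _ _ = refl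
triangle-balance inserted (kept true) removed _ _ _ _ _ _ = refl
triangle-balance inserted (kept true) inserted _ _ _ _ i₁₃ _ = case i₁₃ refl refl of λ ()
triangle-balance inserted (kept false) (kept true) _ _ _ _ _ _ = refl
triangle-balance inserted (kept false) (kept false) _ _ _ _ _ _ = refl
triangle-balance inserted (kept false) removed _ _ _ _ _ _ = refl
triangle-balance inserted (kept false) inserted _ _ _ _ _ _ = refl
triangle-balance inserted removed (kept true) _ _ _ _ _ _ = refl
triangle-balance inserted removed (kept false) _ _ _ _ _ _ = refl
triangle-balance inserted removed removed _ _ _ _ _ _ = refl
triangle-balance inserted removed inserted _ _ _ _ _ _ = refl
triangle-balance inserted inserted (kept true) _ _ _ i₁₂ _ _ = case i₁₂ refl refl of λ ()
triangle-balance inserted inserted (kept false) _ _ _ _ _ _ = refl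
triangle-balance inserted inserted removed _ _ _ _ _ _ = refl
triangle-balance inserted inserted inserted _ _ _ i₁₂ _ _ = case i₁₂ refl refl of λ ()

-- Isomorphism invariants

degree : {n : ℕ} → AdjRel n → Fin n → ℕ
degree {n} A x = ∑[ y < n ] 𝟙 (A x y)

zagreb : {n : ℕ} → AdjRel n → ℕ
zagreb {n} A = ∑[ x < n ] ∑[ y < n ] (𝟙 (A x y) * degree A x * degree A y)

triangles : {n : ℕ} → AdjRel n → ℕ
triangles A = ∑₃ λ z x y → 𝟙 (A x y) * 𝟙 (A x z) * 𝟙 (A y z)

module _ {n : ℕ} {A B : AdjRel n} (iso : Isomorphic A B) where
  private
    σ = proj₁ iso
    π = Bijection.to σ
    A≡B∘π : ∀ x y → A x y ≡ B (π x) (π y)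
    A≡B∘π = proj₂ iso

  degree-iso : ∀ x → degree A x ≡ degree B (π x)
  degree-iso x = trans (sum-cong-≗ λ y → cong 𝟙 (A≡B∘π x y)) (sum-reindex σ (λ y → 𝟙 (B (π x) y)))

  zagreb-iso : zagreb A ≡ zagreb B
  zagreb-iso = trans
    (sum-cong-≗ λ x → sum-cong-≗ λ y →
      cong₂ _*_ (cong₂ _*_ (cong 𝟙 (A≡B∘π x y)) (degree-iso x)) (degree-iso y))
    (sum₂-reindex σ λ x y → 𝟙 (B x y) * degree B x * degree B y)

  triangles-iso : triangles A ≡ triangles B
  triangles-iso = trans
    (∑₃-cong λ z x y → cong₂ _*_ (cong₂ _*_ (cong 𝟙 (A≡B∘π x y)) (cong 𝟙 (A≡B∘π x z))) (cong 𝟙 (A≡B∘π y z)))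
    (∑₃-reindex σ λ z x y → 𝟙 (B x y) * 𝟙 (B x z) * 𝟙 (B y z))

-- Alternating 4-cycles and configurations

record AlternatingCycle {n : ℕ} (A : AdjRel n) (p q r s : Fin n) : Set where
  field
    p≢q : p ≢ q
    p≢r : p ≢ r
    p≢s : p ≢ s
    q≢r : q ≢ r
    q≢s : q ≢ s
    r≢s : r ≢ s
    pq : A p q ≡ true
    rs : A r s ≡ true
    qr : A q r ≡ false
    ps : A p s ≡ false

data Placement {n : ℕ} (p q r s : Fin n) : Fin n → Set where
  at-p : Placement p q r s p
  at-q : Placement p q r s q
  at-r : Placement p q r s r
  at-s : Placement p q r s s
  outside : {z : Fin n} → Outside p q r s z → Placement p q r s z

placement : {n : ℕ} (p q r s z : Fin n) → Placement p q r s z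
placement p q r s z with p ≟ z | q ≟ z | r ≟ z | s ≟ z
... | yes refl | _        | _        | _        = at-p
... | no _     | yes refl | _        | _        = at-q
... | no _     | no _     | yes refl | _        = at-r
... | no _     | no _     | no _     | yes refl = at-s
... | no p≢z   | no q≢z   | no r≢z   | no s≢z   = outside (p≢z , q≢z , r≢z , s≢z)

Outside-reverse : {n : ℕ} {p q r s z : Fin n} → Outside p q r s z → Outside q p s r z
Outside-reverse (p≢z , q≢z , r≢z , s≢z) = q≢z , p≢z , s≢z , r≢z

Outside-rotate : {n : ℕ} {p q r s z : Fin n} → Outside p q r s z → Outside r s p q z
Outside-rotate (p≢z , q≢z , r≢z , s≢z) = r≢z , s≢z , p≢z , q≢z

PrivateNbr : {n : ℕ} → AdjRel n → Fin n → Fin n → Fin n → Set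
PrivateNbr A a b z = A a z ≡ true × A b z ≡ false

private-nbr? : {n : ℕ} (A : AdjRel n) (a b z : Fin n) → Dec (PrivateNbr A a b z)
private-nbr? A a b z = (A a z Bool.≟ true) ×-dec (A b z Bool.≟ false)

PrivateCommonNbr : {n : ℕ} → AdjRel n → Fin n → Fin n → Fin n → Fin n → Fin n → Set
PrivateCommonNbr A a b c d z = A a z ≡ true × A b z ≡ true × A c z ≡ false × A d z ≡ false

module _ {n : ℕ} {A : AdjRel n} where

  ≢-by-nbr : {c x y : Fin n} → A c x ≡ true → A c y ≡ false → x ≢ y
  ≢-by-nbr cx cy refl with trans (sym cx) cy
  ... | ()

  contains-A : {p q r s y z : Fin n} → AlternatingCycle A p q r s →
    Outside p q r s y → Outside p q r s z → PrivateCommonNbr A q r s p y → PrivateCommonNbr A p q r s z →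
    Contains A confA
  contains-A {p} {q} {r} {s} {y} {z} c (p≢y , q≢y , r≢y , s≢y) (p≢z , q≢z , r≢z , s≢z) (qy , ry , sy , py) (pz , qz , rz , sz) =
    lookup vertices , (λ {i} {j} → lookup-injective distinct i j) ,
    pq ∷ rs ∷ qy ∷ ry ∷ pz ∷ qz ∷ [] , qr ∷ ps ∷ py ∷ sy ∷ rz ∷ sz ∷ []
    where
    open AlternatingCycle c
    vertices : Vec (Fin n) 6
    vertices = p ∷ q ∷ r ∷ s ∷ y ∷ z ∷ []
    distinct : Unique vertices
    distinct = (p≢q ∷ p≢r ∷ p≢s ∷ p≢y ∷ p≢z ∷ []) ∷ (q≢r ∷ q≢s ∷ q≢y ∷ q≢z ∷ []) ∷ (r≢s ∷ r≢y ∷ r≢z ∷ [])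
             ∷ (s≢y ∷ s≢z ∷ []) ∷ (≢-sym (≢-by-nbr pz py) ∷ []) ∷ [] ∷ []

  contains-B : {u v w x y z t : Fin n} → AlternatingCycle A u v w x →
    Outside u v w x y → Outside u v w x z → Outside u v w x t → y ≢ z → y ≢ t → z ≢ t →
    PrivateNbr A v x y → PrivateNbr A u w z → PrivateNbr A w u t → Contains A confB
  contains-B {u} {v} {w} {x} {y} {z} {t} c (u≢y , v≢y , w≢y , x≢y) (u≢z , v≢z , w≢z , x≢z) (u≢t , v≢t , w≢t , x≢t)
    y≢z y≢t z≢t (vy , xy) (uz , wz) (wt , ut) =
    lookup vertices , (λ {i} {j} → lookup-injective distinct i j) ,
    pq ∷ rs ∷ vy ∷ uz ∷ wt ∷ [] , qr ∷ ps ∷ xy ∷ wz ∷ ut ∷ []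
    where
    open AlternatingCycle c
    vertices : Vec (Fin n) 7
    vertices = u ∷ v ∷ w ∷ x ∷ y ∷ z ∷ t ∷ []
    distinct : Unique vertices
    distinct = (p≢q ∷ p≢r ∷ p≢s ∷ u≢y ∷ u≢z ∷ u≢t ∷ []) ∷ (q≢r ∷ q≢s ∷ v≢y ∷ v≢z ∷ v≢t ∷ [])
             ∷ (r≢s ∷ w≢y ∷ w≢z ∷ w≢t ∷ []) ∷ (x≢y ∷ x≢z ∷ x≢t ∷ []) ∷ (y≢z ∷ y≢t ∷ []) ∷ (z≢t ∷ []) ∷ [] ∷ []

module SimpleGraph {n : ℕ} {A : AdjRel n} (simple : IsSimple A) where
  private
    symmetric = proj₁ simple
    irreflexive = proj₂ simple

  reverse : {p q r s : Fin n} → AlternatingCycle A p q r s → AlternatingCycle A q p s r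
  reverse {p} {q} {r} {s} c = record
    { p≢q = ≢-sym p≢q ; p≢r = q≢s ; p≢s = q≢r ; q≢r = p≢s ; q≢s = p≢r ; r≢s = ≢-sym r≢s
    ; pq = trans (symmetric q p) pq ; rs = trans (symmetric s r) rs ; qr = ps ; ps = qr }
    where open AlternatingCycle c

  rotate : {p q r s : Fin n} → AlternatingCycle A p q r s → AlternatingCycle A r s p q
  rotate {p} {q} {r} {s} c = record
    { p≢q = r≢s ; p≢r = ≢-sym p≢r ; p≢s = ≢-sym q≢r ; q≢r = ≢-sym p≢s ; q≢s = ≢-sym q≢s ; r≢s = p≢q
    ; pq = rs ; rs = pq ; qr = trans (symmetric s p) ps ; ps = trans (symmetric r q) qr }
    where open AlternatingCycle c

  degree-gap : {u v w x e : Fin n} → AlternatingCycle A u v w x → Outside u v w x e → PrivateNbr A u w e →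
    (∀ t → Outside u v w x t → t ≢ e → ¬ PrivateNbr A w u t) → degree A w < degree A u
  degree-gap {u} {v} {w} {x} {e} c (u≢e , v≢e , w≢e , x≢e) (ue , we) no-private =
    ℕ.≤-pred (ℕ.+-cancelˡ-≤ [uw] _ _ (subst₂ _≤_ sum-lhs sum-rhs (sum-mono-≤ pointwise)))
    where
    open AlternatingCycle c renaming (p≢q to u≢v; p≢r to u≢w; p≢s to u≢x; q≢r to v≢w; q≢s to v≢x; r≢s to w≢x)
    [uw] = 𝟙 (A u w)
    -- Row w is dominated by row u except at t = u and t = w, where the edge uw, if present, sits in
    -- the other row; the first summands put it back.
    lhs rhs : Fin n → ℕ
    lhs t = 𝟙 (⌊ t ≟ w ⌋ ∧ A u w) + (δ v t + (δ e t + 𝟙 (A w t)))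
    rhs t = 𝟙 (⌊ t ≟ u ⌋ ∧ A u w) + (δ x t + 𝟙 (A u t))
    sum-lhs : sum lhs ≡ [uw] + (1 + (1 + degree A w))
    sum-lhs = trans (∑-distrib-+ (λ t → 𝟙 (⌊ t ≟ w ⌋ ∧ A u w)) (λ t → δ v t + (δ e t + 𝟙 (A w t))))
      (cong₂ _+_ (sum-δ-∧ w (A u w)) (trans (∑-distrib-+ (δ v) (λ t → δ e t + 𝟙 (A w t)))
        (cong₂ _+_ (sum-δ-one v) (trans (∑-distrib-+ (δ e) (λ t → 𝟙 (A w t))) (cong (_+ degree A w) (sum-δ-one e))))))
    sum-rhs : sum rhs ≡ [uw] + (1 + degree A u)
    sum-rhs = trans (∑-distrib-+ (λ t → 𝟙 (⌊ t ≟ u ⌋ ∧ A u w)) (λ t → δ x t + 𝟙 (A u t)))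
      (cong₂ _+_ (sum-δ-∧ u (A u w)) (trans (∑-distrib-+ (δ x) (λ t → 𝟙 (A u t))) (cong (_+ degree A u) (sum-δ-one x))))
    pointwise : ∀ t → lhs t ≤ rhs t
    pointwise t with placement u v w x t
    ... | at-p rewrite ≟-≢ u≢w | ≟-≢ u≢v | ≟-≢ u≢e | ≟-refl u | ≟-≢ u≢x | irreflexive u | symmetric w u =
      ℕ.m≤m+n _ 0
    ... | at-q rewrite ≟-≢ v≢w | ≟-refl v | ≟-≢ v≢e | symmetric w v | qr | ≟-≢ (≢-sym u≢v) | ≟-≢ v≢x | pq =
      ℕ.≤-refl
    ... | at-r rewrite ≟-refl w | irreflexive w | ≟-≢ w≢e | ≟-≢ (≢-sym v≢w) | ≟-≢ (≢-sym u≢w) | ≟-≢ w≢x =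
      ℕ.≤-reflexive (ℕ.+-identityʳ _)
    ... | at-s rewrite ≟-≢ (≢-sym w≢x) | ≟-≢ (≢-sym v≢x) | ≟-≢ x≢e | rs | ≟-≢ (≢-sym u≢x) | ≟-refl x | ps =
      ℕ.≤-refl
    ... | outside (u≢t , v≢t , w≢t , x≢t) with t ≟ e
    ...   | yes refl rewrite ≟-≢ (≢-sym w≢t) | ≟-≢ (≢-sym v≢t) | we | ≟-≢ (≢-sym u≢t) | ≟-≢ (≢-sym x≢t) | ue =
      ℕ.≤-refl
    ...   | no t≢e rewrite ≟-≢ (≢-sym w≢t) | ≟-≢ (≢-sym v≢t) | ≟-≢ (≢-sym u≢t) | ≟-≢ (≢-sym x≢t) =
      𝟙-mono (no-private t (u≢t , v≢t , w≢t , x≢t) t≢e)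

  degree-gap-without-B : ¬ Contains A confB → {u v w x y z : Fin n} → AlternatingCycle A u v w x →
    Outside u v w x y → Outside u v w x z → y ≢ z →
    PrivateNbr A v x y ⊎ PrivateNbr A x v y → PrivateNbr A u w z → ¬ PrivateNbr A w u y → degree A w < degree A u
  degree-gap-without-B noB {u} {v} {w} {x} {y} {z} cyc oy oz y≢z vxy uz ¬wuy = degree-gap cyc oz uz no-private
    where
    configuration-B : {t : Fin n} → Outside u v w x t → y ≢ t → z ≢ t → PrivateNbr A w u t →
      PrivateNbr A v x y ⊎ PrivateNbr A x v y → Contains A confB
    configuration-B ot y≢t z≢t wut (inj₁ vy) = contains-B cyc oy oz ot y≢z y≢t z≢t vy uz wut
    configuration-B ot y≢t z≢t wut (inj₂ xy) =
      contains-B (rotate cyc) (Outside-rotate oy) (Outside-rotate ot) (Outside-rotate oz) y≢t y≢z (≢-sym z≢t) xy wut uz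
    no-private : ∀ t → Outside u v w x t → t ≢ z → ¬ PrivateNbr A w u t
    no-private t ot t≢z wut with t ≟ y
    ... | yes refl = ¬wuy wut
    ... | no t≢y = noB (configuration-B ot (≢-sym t≢y) (≢-sym t≢z) wut vxy)

  module Switch {p q r s : Fin n} (cyc : AlternatingCycle A p q r s) where
    open AlternatingCycle cyc

    private
      module Deleted = TwoPairs p≢q p≢r p≢s q≢r q≢s r≢s
      module Added = TwoPairs q≢r (≢-sym p≢q) q≢s (≢-sym p≢r) r≢s p≢s

    deleted added : Fin n → Fin n → Bool
    deleted = Deleted.paired
    added = Added.paired

    A′ : AdjRel n
    A′ = twoSwitch A p q r s

    change : ∀ x y → Change (A x y) (A′ x y) (𝟙 (deleted x y)) (𝟙 (added x y))
    change x y = switch-change (deleted x y) (added x y)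
      (Deleted.paired-elim (λ x y → A x y ≡ true) pq (trans (symmetric q p) pq) rs (trans (symmetric s r) rs))
      (Added.paired-elim (λ x y → A x y ≡ false) qr (trans (symmetric r q) qr) ps (trans (symmetric s p) ps))

    A′-symmetric : ∀ x y → A′ x y ≡ A′ y x
    A′-symmetric x y = cong₂ (λ (e , f) a → switched e f a)
      (cong₂ _,_ (Deleted.paired-sym x y) (Added.paired-sym x y)) (symmetric x y)

    A′-irreflexive : ∀ x → A′ x x ≡ false
    A′-irreflexive x rewrite Deleted.paired-irrefl x | Added.paired-irrefl x = irreflexive x

    A′-outside : {z : Fin n} → Outside p q r s z → ∀ x → A′ x z ≡ A x z
    A′-outside oz@(p≢z , q≢z , r≢z , s≢z) x
      rewrite Deleted.paired-outside x oz | Added.paired-outside x (q≢z , r≢z , p≢z , s≢z) = refl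

    degree-preserved : ∀ x → degree A′ x ≡ degree A x
    degree-preserved x = ℕ.+-cancelʳ-≡ (∑[ y < n ] 𝟙 (deleted x y)) (degree A′ x) (degree A x) (begin
      degree A′ x + ∑[ y < n ] 𝟙 (deleted x y)
        ≡⟨ sum-+-cong (λ y → change-balance (change x y)) ⟩
      degree A x + ∑[ y < n ] 𝟙 (added x y)
        ≡⟨ cong (degree A x +_) (sym same-count) ⟩
      degree A x + ∑[ y < n ] 𝟙 (deleted x y) ∎)
      where
      open ≡-Reasoning
      rearrange : ∀ a b c d → a + b + (c + d) ≡ b + c + (a + d)
      rearrange = solve-∀
      same-count : ∑[ y < n ] 𝟙 (deleted x y) ≡ ∑[ y < n ] 𝟙 (added x y)
      same-count = begin
        ∑[ y < n ] 𝟙 (deleted x y)                       ≡⟨ sum-cong-≗ (λ y → ℕ.*-identityʳ (𝟙 (deleted x y))) ⟨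
        ∑[ y < n ] (𝟙 (deleted x y) * 1)                 ≡⟨ Deleted.sum-paired x (λ _ → 1) ⟩
        δ p x * 1 + δ q x * 1 + (δ r x * 1 + δ s x * 1)  ≡⟨ rearrange (δ p x * 1) _ _ _ ⟩
        δ q x * 1 + δ r x * 1 + (δ p x * 1 + δ s x * 1)  ≡⟨ Added.sum-paired x (λ _ → 1) ⟨
        ∑[ y < n ] (𝟙 (added x y) * 1)                   ≡⟨ sum-cong-≗ (λ y → ℕ.*-identityʳ (𝟙 (added x y))) ⟩
        ∑[ y < n ] 𝟙 (added x y)                         ∎

    private
      d : Fin n → ℕ
      d = degree A

    zagreb-switch : zagreb A′ + (d p * d q + d q * d p + (d r * d s + d s * d r))
                  ≡ zagreb A + (d q * d r + d r * d q + (d p * d s + d s * d p))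
    zagreb-switch = begin
      zagreb A′ + (d p * d q + d q * d p + (d r * d s + d s * d r))
        ≡⟨ cong₂ _+_ zagreb-A′ (Deleted.sum₂-paired D) ⟨
      ∑[ x < n ] ∑[ y < n ] (𝟙 (A′ x y) * D x y) + ∑[ x < n ] ∑[ y < n ] (𝟙 (deleted x y) * D x y)
        ≡⟨ sum-+-cong (λ x → sum-+-cong (λ y → change-balance-* (change x y) (D x y))) ⟩
      ∑[ x < n ] ∑[ y < n ] (𝟙 (A x y) * D x y) + ∑[ x < n ] ∑[ y < n ] (𝟙 (added x y) * D x y)
        ≡⟨ cong₂ _+_ zagreb-A (Added.sum₂-paired D) ⟩
      zagreb A + (d q * d r + d r * d q + (d p * d s + d s * d p)) ∎
      where
      open ≡-Reasoning
      D : Fin n → Fin n → ℕ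
      D x y = d x * d y
      zagreb-A′ : ∑[ x < n ] ∑[ y < n ] (𝟙 (A′ x y) * D x y) ≡ zagreb A′
      zagreb-A′ = sum-cong-≗ λ x → sum-cong-≗ λ y → trans (sym (ℕ.*-assoc (𝟙 (A′ x y)) (d x) (d y)))
        (sym (cong₂ (λ u v → 𝟙 (A′ x y) * u * v) (degree-preserved x) (degree-preserved y)))
      zagreb-A : ∑[ x < n ] ∑[ y < n ] (𝟙 (A x y) * D x y) ≡ zagreb A
      zagreb-A = sum-cong-≗ λ x → sum-cong-≗ λ y → sym (ℕ.*-assoc (𝟙 (A x y)) (d x) (d y))

    lost gained : Fin n → ℕ
    lost z = 𝟙 (A p z ∧ A q z) + 𝟙 (A r z ∧ A s z)
    gained z = 𝟙 (A′ q z ∧ A′ r z) + 𝟙 (A′ p z ∧ A′ s z)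

    triangles-switch : triangles A′ + 6 * sum lost ≡ triangles A + 6 * sum gained
    triangles-switch = begin
      triangles A′ + 6 * sum lost
        ≡⟨ cong (triangles A′ +_)
             (marked-sides (𝟙 ∘₂ A) (𝟙 ∘₂ deleted) A-sym deleted-sym {sum lost} (Deleted.sum₃-paired A)) ⟩
      triangles A′ + ∑₃ (λ z x y → E x y * B x z * B y z + B x y * E x z * B y z + B x y * B x z * E y z)
        ≡⟨ sum-+-cong (λ z → sum-+-cong λ x → sum-+-cong λ y → balance z x y) ⟩
      triangles A + ∑₃ (λ z x y → F x y * B′ x z * B′ y z + B′ x y * F x z * B′ y z + B′ x y * B′ x z * F y z)
        ≡⟨ cong (triangles A +_)
             (sym (marked-sides (𝟙 ∘₂ A′) (𝟙 ∘₂ added) A′-sym added-sym {sum gained} (Added.sum₃-paired A′))) ⟩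
      triangles A + 6 * sum gained ∎
      where
      open ≡-Reasoning
      B B′ E F : Fin n → Fin n → ℕ
      B x y = 𝟙 (A x y)
      B′ x y = 𝟙 (A′ x y)
      E x y = 𝟙 (deleted x y)
      F x y = 𝟙 (added x y)
      marked-sides : (C W : Fin n → Fin n → ℕ) → (∀ x y → C x y ≡ C y x) → (∀ x y → W x y ≡ W y x) → {S : ℕ} →
        ∑₃ (λ z x y → W x y * C x z * C y z) ≡ 2 * S →
        6 * S ≡ ∑₃ (λ z x y → W x y * C x z * C y z + C x y * W x z * C y z + C x y * C x z * W y z)
      marked-sides C W C-sym W-sym {S} one-side = begin
        6 * S                 ≡⟨ ℕ.*-assoc 3 2 S ⟩
        3 * (2 * S)           ≡⟨ cong (3 *_) one-side ⟨
        3 * ∑₃ (λ z x y → W x y * C x z * C y z) ≡⟨ ∑₃-symmetrize C W C-sym W-sym ⟨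
        _ ∎
      A-sym : ∀ x y → B x y ≡ B y x
      A-sym x y = cong 𝟙 (symmetric x y)
      A′-sym : ∀ x y → B′ x y ≡ B′ y x
      A′-sym x y = cong 𝟙 (A′-symmetric x y)
      deleted-sym : ∀ x y → E x y ≡ E y x
      deleted-sym x y = cong 𝟙 (Deleted.paired-sym x y)
      added-sym : ∀ x y → F x y ≡ F y x
      added-sym x y = cong 𝟙 (Added.paired-sym x y)
      balance : ∀ z x y →
        B′ x y * B′ x z * B′ y z + (E x y * B x z * B y z + B x y * E x z * B y z + B x y * B x z * E y z)
        ≡ B x y * B x z * B y z + (F x y * B′ x z * B′ y z + B′ x y * F x z * B′ y z + B′ x y * B′ x z * F y z)
      -- Two deleted (or two inserted) pairs at a common vertex have the same other end, so the third
      -- side of the triple is a loop.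
      balance z x y = triangle-balance (change x y) (change x z) (change y z)
        (λ xy xz → Deleted.paired-shared A irreflexive x y z (𝟙-true xy) (𝟙-true xz))
        (λ xy yz → Deleted.paired-shared A irreflexive y x z (via-sym (Deleted.paired-sym y x) xy) (𝟙-true yz))
        (λ xz yz → Deleted.paired-shared A irreflexive z x y (via-sym (Deleted.paired-sym z x) xz)
                                                                (via-sym (Deleted.paired-sym z y) yz))
        (λ xy xz → Added.paired-shared A′ A′-irreflexive x y z (𝟙-true xy) (𝟙-true xz))
        (λ xy yz → Added.paired-shared A′ A′-irreflexive y x z (via-sym (Added.paired-sym y x) xy) (𝟙-true yz))
        (λ xz yz → Added.paired-shared A′ A′-irreflexive z x y (via-sym (Added.paired-sym z x) xz)
                                                                  (via-sym (Added.paired-sym z y) yz))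
        where
        via-sym : ∀ {u v} → u ≡ v → 𝟙 v ≡ 1 → u ≡ true
        via-sym u≡v v≡1 = trans u≡v (𝟙-true v≡1)

    A′-deleted : {x y : Fin n} → deleted x y ≡ true → A′ x y ≡ false
    A′-deleted {x} {y} xy = cong (λ e → switched e (added x y) (A x y)) xy

    A′pq : A′ p q ≡ false
    A′pq = A′-deleted {p} {q} Deleted.paired-first

    A′rs : A′ r s ≡ false
    A′rs = A′-deleted {r} {s} Deleted.paired-second

    inside-or-outside : (z : Fin n) → Outside p q r s z ⊎ (lost z ≡ 0 × gained z ≡ 0)
    inside-or-outside z with placement p q r s z
    ... | at-p = inj₂ ( cong₂ _+_ (𝟙-∧-zeroˡ _ (irreflexive p)) (𝟙-∧-zeroʳ _ (trans (symmetric s p) ps))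
                      , cong₂ _+_ (𝟙-∧-zeroˡ (A′ r p) (trans (A′-symmetric q p) A′pq)) (𝟙-∧-zeroˡ (A′ s p) (A′-irreflexive p)))
    ... | at-q = inj₂ ( cong₂ _+_ (𝟙-∧-zeroʳ _ (irreflexive q)) (𝟙-∧-zeroˡ _ (trans (symmetric r q) qr))
                      , cong₂ _+_ (𝟙-∧-zeroˡ (A′ r q) (A′-irreflexive q)) (𝟙-∧-zeroˡ (A′ s q) A′pq))
    ... | at-r = inj₂ ( cong₂ _+_ (𝟙-∧-zeroʳ _ qr) (𝟙-∧-zeroˡ _ (irreflexive r))
                      , cong₂ _+_ (𝟙-∧-zeroʳ (A′ q r) (A′-irreflexive r)) (𝟙-∧-zeroʳ (A′ p r) (trans (A′-symmetric s r) A′rs)))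
    ... | at-s = inj₂ ( cong₂ _+_ (𝟙-∧-zeroˡ _ ps) (𝟙-∧-zeroʳ _ (irreflexive s))
                      , cong₂ _+_ (𝟙-∧-zeroʳ (A′ q s) A′rs) (𝟙-∧-zeroʳ (A′ p s) (A′-irreflexive s)))
    ... | outside oz = inj₁ oz

    gained-outside : {z : Fin n} → Outside p q r s z → gained z ≡ 𝟙 (A q z ∧ A r z) + 𝟙 (A p z ∧ A s z)
    gained-outside oz = cong₂ _+_ (cong₂ (λ u v → 𝟙 (u ∧ v)) (A′-outside oz q) (A′-outside oz r))
                                  (cong₂ (λ u v → 𝟙 (u ∧ v)) (A′-outside oz p) (A′-outside oz s))

    LosesTriangle GainsTriangle : Fin n → Set
    LosesTriangle z = PrivateCommonNbr A p q r s z ⊎ PrivateCommonNbr A r s p q z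
    GainsTriangle z = PrivateCommonNbr A q r s p z ⊎ PrivateCommonNbr A s p q r z

    lost≤gained : (∀ z → Outside p q r s z → ¬ LosesTriangle z) → ∀ z → lost z ≤ gained z
    lost≤gained no-loser z with inside-or-outside z
    ... | inj₂ (lost≡0 , _) rewrite lost≡0 = z≤n
    ... | inj₁ oz rewrite gained-outside oz =
      sides-≤ (A p z) (A q z) (A r z) (A s z) (λ l → no-loser z oz (inj₁ l)) (λ l → no-loser z oz (inj₂ l))

    gained≤lost : (∀ z → Outside p q r s z → ¬ GainsTriangle z) → ∀ z → gained z ≤ lost z
    gained≤lost no-gainer z with inside-or-outside z
    ... | inj₂ (_ , gained≡0) rewrite gained≡0 = z≤n
    ... | inj₁ oz rewrite gained-outside oz = subst₂ _≤_
      (cong (λ b → 𝟙 (A q z ∧ A r z) + 𝟙 b) (∧-comm (A s z) (A p z)))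
      (trans (ℕ.+-comm (𝟙 (A r z ∧ A s z)) _) (cong (λ b → 𝟙 b + 𝟙 (A r z ∧ A s z)) (∧-comm (A q z) (A p z))))
      (sides-≤ (A q z) (A r z) (A s z) (A p z) (λ g → no-gainer z oz (inj₁ g)) (λ g → no-gainer z oz (inj₂ g)))

    lost<gained : {w : Fin n} → Outside p q r s w → GainsTriangle w → lost w < gained w
    lost<gained ow (inj₁ (qw , rw , sw , pw)) rewrite gained-outside ow | pw | qw | rw | sw = ℕ.≤-refl
    lost<gained ow (inj₂ (sw , pw , qw , rw)) rewrite gained-outside ow | pw | qw | rw | sw = ℕ.≤-refl

    gained<lost : {w : Fin n} → Outside p q r s w → LosesTriangle w → gained w < lost w
    gained<lost ow (inj₁ (pw , qw , rw , sw)) rewrite gained-outside ow | pw | qw | rw | sw = ℕ.≤-refl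
    gained<lost ow (inj₂ (rw , sw , pw , qw)) rewrite gained-outside ow | pw | qw | rw | sw = ℕ.≤-refl

    gainer-excludes-loser : ¬ Contains A confA → {y z : Fin n} → Outside p q r s y → Outside p q r s z →
      GainsTriangle y → ¬ LosesTriangle z
    gainer-excludes-loser noA oy oz (inj₁ gy) (inj₁ lz) = noA (contains-A cyc oy oz gy lz)
    gainer-excludes-loser noA oy oz (inj₂ (sy , py , qy , ry)) (inj₁ (pz , qz , rz , sz)) =
      noA (contains-A (reverse cyc) (Outside-reverse oy) (Outside-reverse oz) (py , sy , ry , qy) (qz , pz , sz , rz))
    gainer-excludes-loser noA oy oz (inj₁ (qy , ry , sy , py)) (inj₂ (rz , sz , pz , qz)) =
      noA (contains-A (rotate (reverse cyc)) (Outside-rotate (Outside-reverse oy)) (Outside-rotate (Outside-reverse oz))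
                      (ry , qy , py , sy) (sz , rz , qz , pz))
    gainer-excludes-loser noA oy oz (inj₂ gy) (inj₂ lz) =
      noA (contains-A (rotate cyc) (Outside-rotate oy) (Outside-rotate oz) gy lz)

    triangles-preserved⇒lost≡gained : triangles A ≡ triangles A′ → sum lost ≡ sum gained
    triangles-preserved⇒lost≡gained eq = ℕ.*-cancelˡ-≡ (sum lost) (sum gained) 6
      (ℕ.+-cancelˡ-≡ (triangles A′) (6 * sum lost) (6 * sum gained)
        (trans triangles-switch (cong (_+ 6 * sum gained) eq)))

    ¬iso-by-triangles : ¬ Contains A confA → {w : Fin n} → Outside p q r s w → LosesTriangle w ⊎ GainsTriangle w →
      ¬ Isomorphic A A′
    ¬iso-by-triangles noA {w} ow (inj₂ gw) iso =
      ℕ.<-irrefl (triangles-preserved⇒lost≡gained (triangles-iso {B = A′} iso))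
        (sum-mono-< (lost≤gained λ z oz → gainer-excludes-loser noA ow oz gw) w (lost<gained ow gw))
    ¬iso-by-triangles noA {w} ow (inj₁ lw) iso =
      ℕ.<-irrefl (sym (triangles-preserved⇒lost≡gained (triangles-iso {B = A′} iso)))
        (sum-mono-< (gained≤lost λ y oy gy → gainer-excludes-loser noA oy ow gy lw) w (gained<lost ow lw))

    zagreb-preserved⇒degrees-match : zagreb A ≡ zagreb A′ → d p ≡ d r ⊎ d q ≡ d s
    zagreb-preserved⇒degrees-match eq = products-balanced (d p) (d q) (d r) (d s) (ℕ.*-cancelˡ-≡ _ _ 2
      (trans (sym (doubled (d p) (d q) (d r) (d s)))
      (trans (ℕ.+-cancelˡ-≡ (zagreb A′) _ _
               (trans zagreb-switch (cong (_+ (d q * d r + d r * d q + (d p * d s + d s * d p))) eq)))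
             (doubled (d q) (d r) (d p) (d s)))))
      where
      doubled : ∀ a b c e → a * b + b * a + (c * e + e * c) ≡ 2 * (a * b + c * e)
      doubled = solve-∀

    ¬iso-by-zagreb : d p ≢ d r → d q ≢ d s → ¬ Isomorphic A A′
    ¬iso-by-zagreb p≢r q≢s iso with zagreb-preserved⇒degrees-match (zagreb-iso {B = A′} iso)
    ... | inj₁ p≡r = p≢r p≡r
    ... | inj₂ q≡s = q≢s q≡s

    ¬iso-c : ¬ Contains A confA → ¬ Contains A confB → {y z : Fin n} → Outside p q r s y → Outside p q r s z → y ≢ z →
      PrivateNbr A q s y → PrivateNbr A p r z → ¬ Isomorphic A A′
    ¬iso-c noA noB {y} {z} oy oz y≢z (qy , sy) (pz , rz) with private-nbr? A s q z | private-nbr? A r p y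
    ... | yes (sz , qz) | _ = ¬iso-by-triangles noA oz (inj₂ (inj₂ (sz , pz , qz , rz)))
    ... | no _ | yes (ry , py) = ¬iso-by-triangles noA oy (inj₂ (inj₁ (qy , ry , sy , py)))
    ... | no ¬szq | no ¬ryp = ¬iso-by-zagreb (≢-sym (ℕ.<⇒≢ r<p)) (≢-sym (ℕ.<⇒≢ s<q))
      where
      s<q : d s < d q
      s<q = degree-gap-without-B noB (reverse cyc) (Outside-reverse oz) (Outside-reverse oy) (≢-sym y≢z)
                                 (inj₁ (pz , rz)) (qy , sy) ¬szq
      r<p : d r < d p
      r<p = degree-gap-without-B noB cyc oy oz y≢z (inj₁ (qy , sy)) (pz , rz) ¬ryp

    ¬iso-d : ¬ Contains A confA → ¬ Contains A confB → {y z : Fin n} → Outside p q r s y → Outside p q r s z → y ≢ z →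
      PrivateNbr A r p y → PrivateNbr A q s z → ¬ Isomorphic A A′
    ¬iso-d noA noB {y} {z} oy oz y≢z (ry , py) (qz , sz) with private-nbr? A s q y | private-nbr? A p r z
    ... | yes (sy , qy) | _ = ¬iso-by-triangles noA oy (inj₁ (inj₂ (ry , sy , py , qy)))
    ... | no _ | yes (pz , rz) = ¬iso-by-triangles noA oz (inj₁ (inj₁ (pz , qz , rz , sz)))
    ... | no ¬syq | no ¬pzr = ¬iso-by-zagreb (ℕ.<⇒≢ p<r) (≢-sym (ℕ.<⇒≢ s<q))
      where
      s<q : d s < d q
      s<q = degree-gap-without-B noB (reverse cyc) (Outside-reverse oy) (Outside-reverse oz) y≢z
                                 (inj₂ (ry , py)) (qz , sz) ¬syq
      p<r : d p < d r
      p<r = degree-gap-without-B noB (rotate cyc) (Outside-rotate oz) (Outside-rotate oy) (≢-sym y≢z)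
                                 (inj₂ (qz , sz)) (ry , py) ¬pzr

module _ {n m : ℕ} {f : Fin (4 + m) → Fin n} (injective : Injective _≡_ _≡_ f) where
  embedded-≢ : {i j : Fin (4 + m)} → i ≢ j → f i ≢ f j
  embedded-≢ i≢j fi≡fj = i≢j (injective fi≡fj)

  embedded-cycle : {A : AdjRel n} → A (f 0F) (f 1F) ≡ true → A (f 2F) (f 3F) ≡ true →
    A (f 1F) (f 2F) ≡ false → A (f 0F) (f 3F) ≡ false → AlternatingCycle A (f 0F) (f 1F) (f 2F) (f 3F)
  embedded-cycle pq rs qr ps = record
    { p≢q = embedded-≢ (λ ()) ; p≢r = embedded-≢ (λ ()) ; p≢s = embedded-≢ (λ ())
    ; q≢r = embedded-≢ (λ ()) ; q≢s = embedded-≢ (λ ()) ; r≢s = embedded-≢ (λ ())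
    ; pq = pq ; rs = rs ; qr = qr ; ps = ps }

  embedded-outside : (i : Fin m) → Outside (f 0F) (f 1F) (f 2F) (f 3F) (f (4 ↑ʳ i))
  embedded-outside i = embedded-≢ (λ ()) , embedded-≢ (λ ()) , embedded-≢ (λ ()) , embedded-≢ (λ ())

corollary2p4 : (n : ℕ) (adj : AdjRel n) → IsSimple adj
    → ¬ Contains adj confA → ¬ Contains adj confB
    → (C : Config) → C ∈ smallConfigs
    → (f : Fin (k C) → Fin n) → ContainsVia adj C f
    → ¬ Isomorphic adj (twoSwitch adj (f (vp C)) (f (vq C)) (f (vr C)) (f (vs C)))
corollary2p4 n A simple noA noB .confa (here refl) f (inj , pq ∷ rs ∷ qw ∷ rw ∷ [] , qr ∷ ps ∷ pw ∷ sw ∷ []) =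
  ¬iso-by-triangles noA (embedded-outside inj 0F) (inj₂ (inj₁ (qw , rw , sw , pw)))
  where open SimpleGraph.Switch simple (embedded-cycle inj pq rs qr ps)
corollary2p4 n A simple noA noB .confb (there (here refl)) f (inj , pq ∷ rs ∷ pw ∷ qw ∷ [] , qr ∷ ps ∷ rw ∷ sw ∷ []) =
  ¬iso-by-triangles noA (embedded-outside inj 0F) (inj₁ (inj₁ (pw , qw , rw , sw)))
  where open SimpleGraph.Switch simple (embedded-cycle inj pq rs qr ps)
corollary2p4 n A simple noA noB .confc (there (there (here refl))) f (inj , pq ∷ rs ∷ pz ∷ qy ∷ [] , qr ∷ ps ∷ rz ∷ sy ∷ []) =
  ¬iso-c noA noB (embedded-outside inj 0F) (embedded-outside inj 1F) (embedded-≢ inj λ ()) (qy , sy) (pz , rz)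
  where open SimpleGraph.Switch simple (embedded-cycle inj pq rs qr ps)
corollary2p4 n A simple noA noB .confd (there (there (there (here refl)))) f (inj , pq ∷ rs ∷ ry ∷ qz ∷ [] , qr ∷ ps ∷ py ∷ sz ∷ []) =
  ¬iso-d noA noB (embedded-outside inj 0F) (embedded-outside inj 1F) (embedded-≢ inj λ ()) (ry , py) (qz , sz)
  where open SimpleGraph.Switch simple (embedded-cycle inj pq rs qr ps)
corollary2p4 n A simple noA noB C (there (there (there (there ())))) f _
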